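{- Let $N,k,s$ be positive integers with $s\ge3$, and let $\Lambda\subseteq\mathbb{Z}_N$ be a set belonging to the family $\Lambda(k,s)$ with $|\Lambda|\ge k$. Then $$T_k(\Lambda)\le 2^{9k}k^k|\Lambda|^k\cdot 2^{\frac{2sk(\log k)^2}{\log(k^{2s}|\Lambda|^{s-2})}}.$$
   Context: $\mathbb{Z}_N=\mathbb{Z}/N\mathbb{Z}$. A set $\Lambda=\{\lambda_1,\dots,\lambda_{|\Lambda|}\}\subseteq\mathbb{Z}_N$ (distinct elements) belongs to the family $\Lambda(k,s)$ if whenever $\sum_{i=1}^{|\Lambda|}s_i\lambda_i=0\pmod N$ with integers $s_i$ satisfying $|s_i|\le s$ and $\sum_i|s_i|\le 2k$, all $s_i$ are zero. $T_k(\Lambda)$ denotes the number of tuples $(r_1,\dots,r_k,r_1',\dots,r_k')\in\Lambda^{2k}$ with $r_1+\dots+r_k=r_1'+\dots+r_k'$ in $\mathbb{Z}_N$. Here $\log$ denotes the logarithm to base $2$. -}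

module Defs where

open import Data.Nat using (ℕ; zero; suc; _+_; _*_; _^_; _≤_; _<_; _%_; NonZero)
import Data.Nat as ℕ
open import Data.Integer as ℤ using (ℤ; +_; ∣_∣)
open import Data.Integer.Divisibility as ℤD using ()
open import Data.Fin using (Fin; toℕ)
open import Data.List using (List; []; _∷_; [_]; map; concatMap; allFin; foldr; length; filter; cartesianProduct)
open import Data.Vec using (Vec; []; _∷_)
import Data.Vec as Vec
open import Data.Product using (_×_; _,_; proj₁; proj₂)
open import Function.Definitions using (Injective)
open import Relation.Binary.PropositionalEquality using (_≡_)

-- A subset Λ of ℤ_N with |Λ| = n distinct elements is represented as an
-- injective map Λ : Fin n → Fin N (ℤ_N represented by Fin N).

Σℤ : ∀ {n} → (Fin n → ℤ) → ℤ
Σℤ {n} f = foldr ℤ._+_ (+ 0) (map f (allFin n))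

Σℕ : ∀ {n} → (Fin n → ℕ) → ℕ
Σℕ {n} f = foldr _+_ 0 (map f (allFin n))

InFamily : (N k s : ℕ) {n : ℕ} → (Fin n → Fin N) → Set
InFamily N k s {n} Λ =
  (c : Fin n → ℤ) →
  (∀ i → ∣ c i ∣ ≤ s) →
  Σℕ (λ i → ∣ c i ∣) ≤ 2 * k →
  (+ N) ℤD.∣ Σℤ (λ i → c i ℤ.* (+ toℕ (Λ i))) →
  ∀ i → c i ≡ + 0

tuples : (k n : ℕ) → List (Vec (Fin n) k)
tuples zero n = [ [] ]
tuples (suc k) n = concatMap (λ i → map (i ∷_) (tuples k n)) (allFin n)

tupleSum : (N : ℕ) .{{_ : NonZero N}} {n k : ℕ} → (Fin n → Fin N) → Vec (Fin n) k → ℕ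
tupleSum N Λ v = Vec.foldr _ (λ i acc → toℕ (Λ i) + acc) 0 v % N

-- T_k(Λ): number of (r_1..r_k, r'_1..r'_k) ∈ Λ^{2k} with equal sums in ℤ_N.
-- (Tuples of elements of Λ correspond bijectively to tuples of indices,
-- since Λ is injective.)
T : (N : ℕ) .{{_ : NonZero N}} (k : ℕ) {n : ℕ} → (Fin n → Fin N) → ℕ
T N k {n} Λ =
  length (filter (λ uv → tupleSum N Λ (proj₁ uv) ℕ.≟ tupleSum N Λ (proj₂ uv))
                 (cartesianProduct (tuples k n) (tuples k n)))

{-# OPTIONS --safe #-}
module Submission where

-- For a k-tuple v of indices let μ_i(v) be the multiplicity of i in v and
-- blocks v = Σ_i ⌊μ_i(v) / 4⌋.  If two tuples have the same sum in ℤ_N and the same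
-- quotients ⌊μ_i / 4⌋, their multiplicities differ by at most 3 ≤ s in each coordinate and
-- by at most 2k in total, so Λ ∈ Λ(k,s) forces them to be rearrangements of each other.
-- Hence a tuple v with the same sum as u and blocks v ≤ blocks u is determined by the list
-- of its quotients (a word of length ≤ blocks u over n letters: at most (n+1)^(blocks u)
-- choices) together with a rearrangement (k^k choices), and T_k(Λ) ≤ 2 k^k Σ_u (n+1)^(blocks u).
-- If n < k², then blocks u ≤ k/4 and (n+1)^(k/4) ≤ k^(k/2), which is the claimed exponent.
-- If n ≥ k², the weight a = 2 + ⌊n/k⌋ satisfies n + 1 ≤ a³, and 3 · blocks u is at most the
-- number of repeated entries of u, so Σ_u (n+1)^(blocks u) ≤ Σ_u a^(repeats u) ≤ (n + ak)^k
-- ≤ (4n)^k; then T_k(Λ) ≤ 2^(9k) k^k n^k, so the hypothesis p/q < log₂ (T_k(Λ) / 2^(9k) k^k n^k)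
-- cannot hold.

open import Defs
open import Level using (Level)
open import Data.Bool.Base using (true; false; if_then_else_)
open import Data.Empty using (⊥; ⊥-elim)
open import Data.Nat.Base
open import Data.Nat.Properties hiding (_≟_)
import Data.Nat.Properties as ℕ using (_≟_)
open import Algebra.Properties.CommutativeSemigroup +-commutativeSemigroup
  using () renaming (interchange to +-interchange)
open import Algebra.Properties.CommutativeSemigroup *-commutativeSemigroup
  using () renaming (interchange to *-interchange)
open import Data.Nat.DivMod using (m≡m%n+[m/n]*n; m%n<n; m/n*n≤m; m*n/n≡m; /-monoˡ-≤)
open import Data.Nat.Divisibility using (_∣_; divides)
open import Data.Nat.ListAction using (sum)
import Data.Nat.Tactic.RingSolver as ℕ-Solver
import Data.Integer.Base as ℤ
import Data.Integer.Properties as ℤP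
import Data.Integer.Divisibility as ℤD
open import Data.Integer.Tactic.RingSolver using (solve-∀)
open import Data.Fin.Base using (Fin; zero; suc; toℕ)
open import Data.Fin.Properties using (_≟_)
open import Data.List.Base
  using (List; []; _∷_; _++_; foldr; map; concatMap; replicate; allFin; length; filter; find; cartesianProduct)
open import Data.List.Properties
  using (map-tabulate; length-tabulate; length-map; length-++; length-replicate) renaming (≡-dec to ≡-decₗ)
open import Data.List.Membership.Propositional using (_∈_)
open import Data.List.Membership.Propositional.Properties using (∈-map⁺; ∈-concat⁺′; ∈-allFin; ∈-cartesianProduct⁺)
open import Data.List.Relation.Unary.Any using (here; there)
open import Data.Maybe.Base using (fromMaybe)
open import Data.Product.Base using (_×_; _,_; proj₁; proj₂; ∃-syntax)
open import Data.Sum.Base using (_⊎_; inj₁; inj₂)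
open import Data.Vec.Base as Vec using (Vec; []; _∷_)
open import Data.Vec.Properties using () renaming (≡-dec to ≡-decᵥ)
open import Data.Vec.Membership.Propositional using () renaming (_∈_ to _∈ᵥ_)
open import Data.Vec.Relation.Unary.Any as Anyᵥ using (here; there)
open import Data.Vec.Relation.Unary.Any.Properties using (lookup-index)
open import Function.Base using (_∘_)
open import Function.Definitions using (Injective)
open import Relation.Binary.Definitions using (DecidableEquality)
open import Relation.Binary.PropositionalEquality
open import Relation.Nullary.Decidable using (Dec; yes; no; does; _×-dec_)
open import Relation.Nullary.Negation using (contradiction)
open import Relation.Unary using (Pred; Decidable)

private
  variable
    ℓ ℓ′ ℓ″ : Level
    A : Set ℓ
    B : Set ℓ′

∑ : (A → ℕ) → List A → ℕ
∑ f xs = sum (map f xs)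

infix 6.5 ∑
syntax ∑ (λ x → e) xs = ∑[ x ∈ xs ] e

module _ {f g : A → ℕ} where

  ∑-cong : (∀ x → f x ≡ g x) → ∀ xs → ∑ f xs ≡ ∑ g xs
  ∑-cong f≗g []       = refl
  ∑-cong f≗g (x ∷ xs) = cong₂ _+_ (f≗g x) (∑-cong f≗g xs)

  ∑-mono-≤ : (∀ x → f x ≤ g x) → ∀ xs → ∑ f xs ≤ ∑ g xs
  ∑-mono-≤ f≤g []       = z≤n
  ∑-mono-≤ f≤g (x ∷ xs) = +-mono-≤ (f≤g x) (∑-mono-≤ f≤g xs)

  ∑-distrib-+ : ∀ xs → ∑[ x ∈ xs ] (f x + g x) ≡ ∑ f xs + ∑ g xs
  ∑-distrib-+ []       = refl
  ∑-distrib-+ (x ∷ xs) =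
    trans (cong (f x + g x +_) (∑-distrib-+ xs)) (+-interchange (f x) (g x) (∑ f xs) (∑ g xs))

*-distribˡ-∑ : ∀ c (f : A → ℕ) xs → ∑[ x ∈ xs ] c * f x ≡ c * ∑ f xs
*-distribˡ-∑ c f []       = sym (*-zeroʳ c)
*-distribˡ-∑ c f (x ∷ xs) = trans (cong (c * f x +_) (*-distribˡ-∑ c f xs)) (sym (*-distribˡ-+ c (f x) _))

∑-const : ∀ c (xs : List A) → ∑[ x ∈ xs ] c ≡ length xs * c
∑-const c []       = refl
∑-const c (x ∷ xs) = cong (c +_) (∑-const c xs)

∑-zero : (xs : List A) → ∑[ x ∈ xs ] 0 ≡ 0
∑-zero xs = trans (∑-const 0 xs) (*-zeroʳ (length xs))

length≡∑1 : (xs : List A) → length xs ≡ ∑[ x ∈ xs ] 1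
length≡∑1 xs = sym (trans (∑-const 1 xs) (*-identityʳ (length xs)))

∑-replicate : ∀ (f : A → ℕ) m x → ∑ f (replicate m x) ≡ m * f x
∑-replicate f zero    x = refl
∑-replicate f (suc m) x = cong (f x +_) (∑-replicate f m x)

∑-++ : ∀ (f : A → ℕ) xs ys → ∑ f (xs ++ ys) ≡ ∑ f xs + ∑ f ys
∑-++ f []       ys = refl
∑-++ f (x ∷ xs) ys = trans (cong (f x +_) (∑-++ f xs ys)) (sym (+-assoc (f x) _ _))

∑-map : ∀ (f : B → ℕ) (g : A → B) xs → ∑ f (map g xs) ≡ ∑ (f ∘ g) xs
∑-map f g []       = refl
∑-map f g (x ∷ xs) = cong (f (g x) +_) (∑-map f g xs)

∑-concatMap : ∀ (f : B → ℕ) (g : A → List B) xs → ∑ f (concatMap g xs) ≡ ∑[ x ∈ xs ] ∑ f (g x)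
∑-concatMap f g []       = refl
∑-concatMap f g (x ∷ xs) = trans (∑-++ f (g x) (concatMap g xs)) (cong (∑ f (g x) +_) (∑-concatMap f g xs))

∑-cartesianProduct : ∀ (f : A × B → ℕ) xs ys →
                     ∑ f (cartesianProduct xs ys) ≡ ∑[ x ∈ xs ] ∑[ y ∈ ys ] f (x , y)
∑-cartesianProduct f []       ys = refl
∑-cartesianProduct f (x ∷ xs) ys =
  trans (∑-++ f (map (x ,_) ys) (cartesianProduct xs ys)) (cong₂ _+_ (∑-map f (x ,_) ys) (∑-cartesianProduct f xs ys))

∑-comm : ∀ (f : A → B → ℕ) xs ys → ∑[ x ∈ xs ] ∑[ y ∈ ys ] f x y ≡ ∑[ y ∈ ys ] ∑[ x ∈ xs ] f x y
∑-comm f []       ys = sym (∑-zero ys)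
∑-comm f (x ∷ xs) ys = trans (cong (∑ (f x) ys +_) (∑-comm f xs ys)) (sym (∑-distrib-+ ys))

≤-∑ : ∀ (f : A → ℕ) {x xs} → x ∈ xs → f x ≤ ∑ f xs
≤-∑ f (here refl)  = m≤m+n _ _
≤-∑ f (there x∈xs) = ≤-trans (≤-∑ f x∈xs) (m≤n+m _ _)

length-concatMap : ∀ (g : A → List B) xs → length (concatMap g xs) ≡ ∑[ x ∈ xs ] length (g x)
length-concatMap g []       = refl
length-concatMap g (x ∷ xs) = trans (length-++ (g x)) (cong (length (g x) +_) (length-concatMap g xs))

length-cartesianProduct : ∀ (xs : List A) (ys : List B) →
                          length (cartesianProduct xs ys) ≡ length xs * length ys
length-cartesianProduct []       ys = refl
length-cartesianProduct (x ∷ xs) ys =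
  trans (length-++ (map (x ,_) ys)) (cong₂ _+_ (length-map (x ,_) ys) (length-cartesianProduct xs ys))

∑-allFin-suc : ∀ {n} (f : Fin (suc n) → ℕ) → ∑ f (allFin (suc n)) ≡ f zero + ∑ (f ∘ suc) (allFin n)
∑-allFin-suc {n} f =
  cong (f zero +_) (trans (cong (∑ f) (sym (map-tabulate (λ i → i) suc))) (∑-map f suc (allFin n)))

𝟙 : {P : Set ℓ″} → Dec P → ℕ
𝟙 P? = if does P? then 1 else 0

𝟙-yes : {P : Set ℓ″} (P? : Dec P) → P → 𝟙 P? ≡ 1
𝟙-yes (yes _) _  = refl
𝟙-yes (no ¬p) p  = contradiction p ¬p

𝟙-×-dec : {P Q : Set ℓ″} (P? : Dec P) (Q? : Dec Q) → 𝟙 (P? ×-dec Q?) ≡ 𝟙 P? * 𝟙 Q?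
𝟙-×-dec (yes _) Q? = sym (+-identityʳ (𝟙 Q?))
𝟙-×-dec (no _)  Q? = refl

𝟙≤𝟙+𝟙 : {P Q R : Set ℓ″} (P? : Dec P) (Q? : Dec Q) (R? : Dec R) → (P → Q ⊎ R) → 𝟙 P? ≤ 𝟙 Q? + 𝟙 R?
𝟙≤𝟙+𝟙 (no _)  Q? R? P⇒Q⊎R = z≤n
𝟙≤𝟙+𝟙 (yes p) Q? R? P⇒Q⊎R with P⇒Q⊎R p
... | inj₁ q = ≤-trans (≤-reflexive (sym (𝟙-yes Q? q))) (m≤m+n (𝟙 Q?) (𝟙 R?))
... | inj₂ r = ≤-trans (≤-reflexive (sym (𝟙-yes R? r))) (m≤n+m (𝟙 R?) (𝟙 Q?))

[𝟙+m]∸1 : {P : Set ℓ″} (P? : Dec P) (m : ℕ) → (𝟙 P? + m) ∸ 1 ≡ (m ∸ 1) + 𝟙 P? * (1 ⊓ m)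
[𝟙+m]∸1 (yes _) zero    = refl
[𝟙+m]∸1 (yes _) (suc m) = +-comm 1 m
[𝟙+m]∸1 (no _)  m       = sym (+-identityʳ (m ∸ 1))

length-filter : {P : Pred A ℓ″} (P? : Decidable P) → ∀ xs → length (filter P? xs) ≡ ∑[ x ∈ xs ] 𝟙 (P? x)
length-filter P? []       = refl
length-filter P? (x ∷ xs) with does (P? x)
... | true  = cong suc (length-filter P? xs)
... | false = length-filter P? xs

∑-𝟙≟ : ∀ {n} (i : Fin n) (g : Fin n → ℕ) → ∑[ j ∈ allFin n ] 𝟙 (i ≟ j) * g j ≡ g i
∑-𝟙≟ {suc n} zero    g = begin
  ∑[ j ∈ allFin (suc n) ] 𝟙 (zero ≟ j) * g j  ≡⟨ ∑-allFin-suc (λ j → 𝟙 (zero ≟ j) * g j) ⟩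
  g zero + 0 + ∑ (λ _ → 0) (allFin n)         ≡⟨ cong₂ _+_ (+-identityʳ (g zero)) (∑-zero (allFin n)) ⟩
  g zero + 0                                  ≡⟨ +-identityʳ (g zero) ⟩
  g zero                                      ∎
  where open ≡-Reasoning
∑-𝟙≟ {suc n} (suc i) g = trans (∑-allFin-suc (λ j → 𝟙 (suc i ≟ j) * g j)) (∑-𝟙≟ i (g ∘ suc))

module _ {P : Pred A ℓ″} (P? : Decidable P) (_≟ₐ_ : DecidableEquality A) {xs ys : List A} where

  ∑𝟙≤length : (∀ y → ∑[ x ∈ xs ] 𝟙 (y ≟ₐ x) ≤ 1) → (∀ {x} → P x → x ∈ ys) →
              ∑[ x ∈ xs ] 𝟙 (P? x) ≤ length ys
  ∑𝟙≤length xs-distinct P⊆ys = begin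
    ∑[ x ∈ xs ] 𝟙 (P? x)                ≤⟨ ∑-mono-≤ 𝟙P≤occurrences xs ⟩
    ∑[ x ∈ xs ] ∑[ y ∈ ys ] 𝟙 (y ≟ₐ x)  ≡⟨ ∑-comm (λ x y → 𝟙 (y ≟ₐ x)) xs ys ⟩
    ∑[ y ∈ ys ] ∑[ x ∈ xs ] 𝟙 (y ≟ₐ x)  ≤⟨ ∑-mono-≤ xs-distinct ys ⟩
    ∑[ y ∈ ys ] 1                       ≡⟨ length≡∑1 ys ⟨
    length ys                           ∎
    where
    open ≤-Reasoning
    𝟙P≤occurrences : ∀ x → 𝟙 (P? x) ≤ ∑[ y ∈ ys ] 𝟙 (y ≟ₐ x)
    𝟙P≤occurrences x with P? x
    ... | yes px = subst (_≤ ∑[ y ∈ ys ] 𝟙 (y ≟ₐ x)) (𝟙-yes (x ≟ₐ x) refl)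
                         (≤-∑ (λ y → 𝟙 (y ≟ₐ x)) (P⊆ys px))
    ... | no _   = z≤n

find-satisfies : {P : Pred A ℓ″} (P? : Decidable P) (d : A) {x : A} {xs : List A} →
                 x ∈ xs → P x → P (fromMaybe d (find P? xs))
find-satisfies P? d {xs = y ∷ xs} x∈xs px with P? y
... | yes py = py
find-satisfies P? d (here refl)   px | no ¬py = contradiction px ¬py
find-satisfies P? d (there x∈xs) px | no _   = find-satisfies P? d x∈xs px

-- Tuples and multiplicities

∑-tuples-suc : ∀ {m n} (f : Vec (Fin n) (suc m) → ℕ) →
               ∑ f (tuples (suc m) n) ≡ ∑[ i ∈ allFin n ] ∑[ w ∈ tuples m n ] f (i ∷ w)
∑-tuples-suc {m} {n} f = trans (∑-concatMap f _ (allFin n)) (∑-cong (λ i → ∑-map f (i ∷_) (tuples m n)) (allFin n))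

length-tuples : ∀ m n → length (tuples m n) ≡ n ^ m
length-tuples zero    n = refl
length-tuples (suc m) n = begin
  length (tuples (suc m) n)                           ≡⟨ length-concatMap (λ i → map (i ∷_) (tuples m n)) (allFin n) ⟩
  ∑[ i ∈ allFin n ] length (map (i ∷_) (tuples m n))  ≡⟨ ∑-cong |i∷tuples| (allFin n) ⟩
  ∑[ i ∈ allFin n ] n ^ m                             ≡⟨ ∑-const (n ^ m) (allFin n) ⟩
  length (allFin n) * n ^ m                           ≡⟨ cong (_* n ^ m) (length-tabulate {n = n} (λ i → i)) ⟩
  n * n ^ m                                           ∎
  where
  open ≡-Reasoning
  |i∷tuples| : ∀ i → length (map (i ∷_) (tuples m n)) ≡ n ^ m
  |i∷tuples| i = trans (length-map (i ∷_) (tuples m n)) (length-tuples m n)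

∈-tuples : ∀ {m n} (v : Vec (Fin n) m) → v ∈ tuples m n
∈-tuples []      = here refl
∈-tuples (i ∷ w) = ∈-concat⁺′ (∈-map⁺ (i ∷_) (∈-tuples w)) (∈-map⁺ _ (∈-allFin i))

infix 4 _≟ᵥ_
_≟ᵥ_ : ∀ {m n} → DecidableEquality (Vec (Fin n) m)
_≟ᵥ_ = ≡-decᵥ _≟_

∑-tuples-𝟙≟ : ∀ {m n} (y : Vec (Fin n) m) → ∑[ v ∈ tuples m n ] 𝟙 (y ≟ᵥ v) ≡ 1
∑-tuples-𝟙≟          []       = refl
∑-tuples-𝟙≟ {suc m} {n} (y ∷ ys) = begin
  ∑[ v ∈ tuples (suc m) n ] 𝟙 (y ∷ ys ≟ᵥ v)
    ≡⟨ ∑-tuples-suc (𝟙 ∘ (y ∷ ys ≟ᵥ_)) ⟩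
  ∑[ i ∈ allFin n ] ∑[ w ∈ W ] 𝟙 (y ∷ ys ≟ᵥ i ∷ w)
    ≡⟨ ∑-cong (λ i → ∑-cong (λ w → 𝟙-×-dec (y ≟ i) (ys ≟ᵥ w)) W) (allFin n) ⟩
  ∑[ i ∈ allFin n ] ∑[ w ∈ W ] 𝟙 (y ≟ i) * 𝟙 (ys ≟ᵥ w)
    ≡⟨ ∑-cong (λ i → *-distribˡ-∑ (𝟙 (y ≟ i)) _ W) (allFin n) ⟩
  ∑[ i ∈ allFin n ] 𝟙 (y ≟ i) * (∑[ w ∈ W ] 𝟙 (ys ≟ᵥ w))
    ≡⟨ ∑-cong (λ i → cong (𝟙 (y ≟ i) *_) (∑-tuples-𝟙≟ ys)) (allFin n) ⟩
  ∑[ i ∈ allFin n ] 𝟙 (y ≟ i) * 1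
    ≡⟨ ∑-𝟙≟ y (λ _ → 1) ⟩
  1 ∎
  where
  open ≡-Reasoning
  W = tuples m n

multiplicity : ∀ {m n} → Vec (Fin n) m → Fin n → ℕ
multiplicity []      i = 0
multiplicity (x ∷ v) i = 𝟙 (x ≟ i) + multiplicity v i

-- tupleSum N Λ v is ∑ᵥ (toℕ ∘ Λ) v % N by definition.
∑ᵥ : ∀ {m n} → (Fin n → ℕ) → Vec (Fin n) m → ℕ
∑ᵥ g v = Vec.foldr _ (λ x acc → g x + acc) 0 v

module _ {n : ℕ} where

  ∑-multiplicity : ∀ {m} (v : Vec (Fin n) m) → ∑[ i ∈ allFin n ] multiplicity v i ≡ m
  ∑-multiplicity []      = ∑-zero (allFin n)
  ∑-multiplicity (x ∷ v) = begin
    ∑[ i ∈ allFin n ] (𝟙 (x ≟ i) + multiplicity v i)             ≡⟨ ∑-distrib-+ (allFin n) ⟩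
    ∑[ i ∈ allFin n ] 𝟙 (x ≟ i) + ∑ (multiplicity v) (allFin n)  ≡⟨ cong₂ _+_ ∑𝟙≡1 (∑-multiplicity v) ⟩
    suc _                                                        ∎
    where
    open ≡-Reasoning
    ∑𝟙≡1 : ∑[ i ∈ allFin n ] 𝟙 (x ≟ i) ≡ 1
    ∑𝟙≡1 = trans (∑-cong (λ i → sym (*-identityʳ (𝟙 (x ≟ i)))) (allFin n)) (∑-𝟙≟ x (λ _ → 1))

  ∑-multiplicity-* : ∀ {m} (v : Vec (Fin n) m) (g : Fin n → ℕ) → ∑[ i ∈ allFin n ] multiplicity v i * g i ≡ ∑ᵥ g v
  ∑-multiplicity-* []      g = ∑-zero (allFin n)
  ∑-multiplicity-* (x ∷ v) g = begin
    ∑[ i ∈ allFin n ] (𝟙 (x ≟ i) + multiplicity v i) * g i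
      ≡⟨ ∑-cong (λ i → *-distribʳ-+ (g i) (𝟙 (x ≟ i)) _) (allFin n) ⟩
    ∑[ i ∈ allFin n ] (𝟙 (x ≟ i) * g i + multiplicity v i * g i)
      ≡⟨ ∑-distrib-+ (allFin n) ⟩
    ∑[ i ∈ allFin n ] 𝟙 (x ≟ i) * g i + ∑[ i ∈ allFin n ] multiplicity v i * g i
      ≡⟨ cong₂ _+_ (∑-𝟙≟ x g) (∑-multiplicity-* v g) ⟩
    g x + ∑ᵥ g v ∎
    where open ≡-Reasoning

  ∈⇒multiplicity>0 : ∀ {m} {v : Vec (Fin n) m} {x} → x ∈ᵥ v → 0 < multiplicity v x
  ∈⇒multiplicity>0 {x = x}     (here refl) = ≤-trans (≤-reflexive (sym (𝟙-yes (x ≟ x) refl))) (m≤m+n _ _)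
  ∈⇒multiplicity>0 {v = y ∷ v} (there x∈v) = ≤-trans (∈⇒multiplicity>0 x∈v) (m≤n+m _ (𝟙 (y ≟ _)))

  multiplicity>0⇒∈ : ∀ {m} (v : Vec (Fin n) m) {x} → 0 < multiplicity v x → x ∈ᵥ v
  multiplicity>0⇒∈ (y ∷ v) {x} μ>0 with y ≟ x
  ... | yes refl = here refl
  ... | no _     = there (multiplicity>0⇒∈ v μ>0)

rearrangement : ∀ {m m′} {v : Vec A m} {w : Vec A m′} → (∀ {x} → x ∈ᵥ v → x ∈ᵥ w) →
                ∃[ σ ] Vec.map (Vec.lookup w) σ ≡ v
rearrangement {v = []}    v⊆w = [] , refl
rearrangement {v = x ∷ v} v⊆w with rearrangement (v⊆w ∘ there)
... | σ , wσ≡v = Anyᵥ.index x∈w ∷ σ , cong₂ _∷_ (sym (lookup-index x∈w)) wσ≡v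
  where x∈w = v⊆w (here refl)

-- Consequences of Λ ∈ Λ(k,s)

module _ (d : ℕ) .{{_ : NonZero d}} where

  m/d≡n/d⇒∣m-n∣<d : ∀ {m n} → m / d ≡ n / d → ∣ m - n ∣ < d
  m/d≡n/d⇒∣m-n∣<d {m} {n} m/d≡n/d = begin-strict
    ∣ m - n ∣                                  ≡⟨ cong₂ ∣_-_∣ (split m) n≡m/d*d+n%d ⟩
    ∣ m / d * d + m % d - m / d * d + n % d ∣  ≡⟨ ∣m+n-m+o∣≡∣n-o∣ (m / d * d) (m % d) (n % d) ⟩
    ∣ m % d - n % d ∣                          ≤⟨ ∣m-n∣≤m⊔n (m % d) (n % d) ⟩
    m % d ⊔ n % d                              <⟨ ⊔-lub (m%n<n m d) (m%n<n n d) ⟩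
    d                                          ∎
    where
    open ≤-Reasoning
    split : ∀ m → m ≡ m / d * d + m % d
    split m = trans (m≡m%n+[m/n]*n m d) (+-comm (m % d) _)
    n≡m/d*d+n%d : n ≡ m / d * d + n % d
    n≡m/d*d+n%d = trans (split n) (cong (λ q → q * d + n % d) (sym m/d≡n/d))

  m%d≡n%d⇒d∣∣m-n∣ : ∀ {m n} → m % d ≡ n % d → d ∣ ∣ m - n ∣
  m%d≡n%d⇒d∣∣m-n∣ {m} {n} m%d≡n%d = divides ∣ m / d - n / d ∣ (begin
    ∣ m - n ∣                                  ≡⟨ cong₂ ∣_-_∣ (m≡m%n+[m/n]*n m d) n≡m%d+n/d*d ⟩
    ∣ m % d + m / d * d - m % d + n / d * d ∣  ≡⟨ ∣m+n-m+o∣≡∣n-o∣ (m % d) _ _ ⟩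
    ∣ m / d * d - n / d * d ∣                  ≡⟨ *-distribʳ-∣-∣ d (m / d) (n / d) ⟨
    ∣ m / d - n / d ∣ * d                      ∎)
    where
    open ≡-Reasoning
    n≡m%d+n/d*d : n ≡ m % d + n / d * d
    n≡m%d+n/d*d = trans (m≡m%n+[m/n]*n n d) (cong (_+ n / d * d) (sym m%d≡n%d))

-- ℤ's +_ is opened only here: elsewhere it would make sections such as (x +_) ambiguous.
module _ where
  open ℤ using (+_)

  ∣+m-+n∣≡∣m-n∣ : ∀ m n → ℤ.∣ + m ℤ.- + n ∣ ≡ ∣ m - n ∣
  ∣+m-+n∣≡∣m-n∣ m n with ≤-total m n
  ... | inj₁ m≤n = begin
    ℤ.∣ + m ℤ.- + n ∣  ≡⟨ cong ℤ.∣_∣ (ℤP.[+m]-[+n]≡m⊖n m n) ⟩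
    ℤ.∣ m ℤ.⊖ n ∣      ≡⟨ ℤP.∣⊖∣-≤ m≤n ⟩
    n ∸ m              ≡⟨ m≤n⇒∣m-n∣≡n∸m m≤n ⟨
    ∣ m - n ∣          ∎
    where open ≡-Reasoning
  ... | inj₂ n≤m = begin
    ℤ.∣ + m ℤ.- + n ∣  ≡⟨ cong ℤ.∣_∣ (ℤP.[+m]-[+n]≡m⊖n m n) ⟩
    ℤ.∣ m ℤ.⊖ n ∣      ≡⟨ ℤP.∣m⊖n∣≡∣n⊖m∣ m n ⟩
    ℤ.∣ n ℤ.⊖ m ∣      ≡⟨ ℤP.∣⊖∣-≤ n≤m ⟩
    m ∸ n              ≡⟨ m≤n⇒∣n-m∣≡n∸m n≤m ⟨
    ∣ m - n ∣          ∎
    where open ≡-Reasoning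

  ∑ℤ-difference : ∀ (f g h : A → ℕ) xs →
                  foldr ℤ._+_ (+ 0) (map (λ x → (+ f x ℤ.- + g x) ℤ.* + h x) xs)
                    ≡ + (∑[ x ∈ xs ] f x * h x) ℤ.- + (∑[ x ∈ xs ] g x * h x)
  ∑ℤ-difference f g h []       = refl
  ∑ℤ-difference f g h (x ∷ xs) = begin
    (+ f x ℤ.- + g x) ℤ.* + h x ℤ.+ foldr ℤ._+_ (+ 0) (map (λ x → (+ f x ℤ.- + g x) ℤ.* + h x) xs)
      ≡⟨ cong (λ z → (+ f x ℤ.- + g x) ℤ.* + h x ℤ.+ z) (∑ℤ-difference f g h xs) ⟩
    (+ f x ℤ.- + g x) ℤ.* + h x ℤ.+ (+ F ℤ.- + G)
      ≡⟨ regroup (+ f x) (+ g x) (+ h x) (+ F) (+ G) ⟩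
    (+ f x ℤ.* + h x ℤ.+ + F) ℤ.- (+ g x ℤ.* + h x ℤ.+ + G)
      ≡⟨ cong₂ (λ a b → (a ℤ.+ + F) ℤ.- (b ℤ.+ + G)) (ℤP.pos-* (f x) (h x)) (ℤP.pos-* (g x) (h x)) ⟨
    (+ (f x * h x) ℤ.+ + F) ℤ.- (+ (g x * h x) ℤ.+ + G)
      ≡⟨ cong₂ ℤ._-_ (ℤP.pos-+ (f x * h x) F) (ℤP.pos-+ (g x * h x) G) ⟨
    + (f x * h x + F) ℤ.- + (g x * h x + G) ∎
    where
    open ≡-Reasoning
    F = ∑[ x ∈ xs ] f x * h x
    G = ∑[ x ∈ xs ] g x * h x
    regroup : ∀ (a b c x y : ℤ.ℤ) → (a ℤ.- b) ℤ.* c ℤ.+ (x ℤ.- y) ≡ (a ℤ.* c ℤ.+ x) ℤ.- (b ℤ.* c ℤ.+ y)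
    regroup = solve-∀

  module _ {N k s n : ℕ} .{{_ : NonZero N}} {Λ : Fin n → Fin N} (Λ∈Λ[k,s] : InFamily N k s Λ) where

    close-multiplicities⇒equal : (v w : Vec (Fin n) k) → tupleSum N Λ v ≡ tupleSum N Λ w →
                                 (∀ i → ∣ multiplicity v i - multiplicity w i ∣ ≤ s) →
                                 ∀ i → multiplicity v i ≡ multiplicity w i
    close-multiplicities⇒equal v w v≡w close i =
      ℤP.+-injective (ℤP.i-j≡0⇒i≡j _ _ (Λ∈Λ[k,s] c ∣c∣≤s ∑∣c∣≤2k N∣∑cΛ i))
      where
      μv μw : Fin n → ℕ
      μv = multiplicity v
      μw = multiplicity w

      c : Fin n → ℤ.ℤ
      c i = + μv i ℤ.- + μw i

      ∣c∣≤s : ∀ i → ℤ.∣ c i ∣ ≤ s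
      ∣c∣≤s i = subst (_≤ s) (sym (∣+m-+n∣≡∣m-n∣ (μv i) (μw i))) (close i)

      ∑∣c∣≤2k : Σℕ (λ i → ℤ.∣ c i ∣) ≤ 2 * k
      ∑∣c∣≤2k = begin
        ∑[ i ∈ allFin n ] ℤ.∣ c i ∣              ≡⟨ ∑-cong (λ i → ∣+m-+n∣≡∣m-n∣ (μv i) (μw i)) (allFin n) ⟩
        ∑[ i ∈ allFin n ] ∣ μv i - μw i ∣        ≤⟨ ∑-mono-≤ (λ i → ∣m-n∣≤m+n (μv i) (μw i)) (allFin n) ⟩
        ∑[ i ∈ allFin n ] (μv i + μw i)          ≡⟨ ∑-distrib-+ (allFin n) ⟩
        ∑ μv (allFin n) + ∑ μw (allFin n)        ≡⟨ cong₂ _+_ (∑-multiplicity v) (∑-multiplicity w) ⟩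
        k + k                                    ≡⟨ cong (λ m → k + m) (+-identityʳ k) ⟨
        2 * k                                    ∎
        where
        open ≤-Reasoning
        ∣m-n∣≤m+n : ∀ m n → ∣ m - n ∣ ≤ m + n
        ∣m-n∣≤m+n m n = ≤-trans (∣m-n∣≤m⊔n m n) (m⊔n≤m+n m n)

      N∣∑cΛ : (+ N) ℤD.∣ Σℤ (λ i → c i ℤ.* + toℕ (Λ i))
      N∣∑cΛ = subst (N ∣_) (sym ∣∑cΛ∣≡) (m%d≡n%d⇒d∣∣m-n∣ N v≡w)
        where
        open ≡-Reasoning
        g : Fin n → ℕ
        g i = toℕ (Λ i)
        ∣∑cΛ∣≡ : ℤ.∣ Σℤ (λ i → c i ℤ.* + g i) ∣ ≡ ∣ ∑ᵥ g v - ∑ᵥ g w ∣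
        ∣∑cΛ∣≡ = begin
          ℤ.∣ Σℤ (λ i → c i ℤ.* + g i) ∣
            ≡⟨ cong ℤ.∣_∣ (∑ℤ-difference μv μw g (allFin n)) ⟩
          ℤ.∣ + (∑[ i ∈ allFin n ] μv i * g i) ℤ.- + (∑[ i ∈ allFin n ] μw i * g i) ∣
            ≡⟨ ∣+m-+n∣≡∣m-n∣ (∑[ i ∈ allFin n ] μv i * g i) (∑[ i ∈ allFin n ] μw i * g i) ⟩
          ∣ ∑[ i ∈ allFin n ] μv i * g i - ∑[ i ∈ allFin n ] μw i * g i ∣
            ≡⟨ cong₂ ∣_-_∣ (∑-multiplicity-* v g) (∑-multiplicity-* w g) ⟩
          ∣ ∑ᵥ g v - ∑ᵥ g w ∣ ∎

-- Block codes

module _ {n : ℕ} where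

  blocks : ∀ {m} → Vec (Fin n) m → ℕ
  blocks v = ∑[ i ∈ allFin n ] multiplicity v i / 4

  blockCode : ∀ {m} → Vec (Fin n) m → List (Fin n)
  blockCode v = concatMap (λ i → replicate (multiplicity v i / 4) i) (allFin n)

  length-blockCode : ∀ {m} (v : Vec (Fin n) m) → length (blockCode v) ≡ blocks v
  length-blockCode v = trans (length-concatMap (λ i → replicate (multiplicity v i / 4) i) (allFin n))
                             (∑-cong (λ i → length-replicate (multiplicity v i / 4)) (allFin n))

  ∑-blockCode-𝟙≟ : ∀ {m} (v : Vec (Fin n) m) i → ∑[ x ∈ blockCode v ] 𝟙 (i ≟ x) ≡ multiplicity v i / 4
  ∑-blockCode-𝟙≟ v i = begin
    ∑[ x ∈ blockCode v ] 𝟙 (i ≟ x)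
      ≡⟨ ∑-concatMap (𝟙 ∘ (i ≟_)) (λ j → replicate (q j) j) (allFin n) ⟩
    ∑[ j ∈ allFin n ] ∑[ x ∈ replicate (q j) j ] 𝟙 (i ≟ x)
      ≡⟨ ∑-cong (λ j → trans (∑-replicate (𝟙 ∘ (i ≟_)) (q j) j) (*-comm (q j) _)) (allFin n) ⟩
    ∑[ j ∈ allFin n ] 𝟙 (i ≟ j) * q j
      ≡⟨ ∑-𝟙≟ i q ⟩
    q i ∎
    where
    open ≡-Reasoning
    q : Fin n → ℕ
    q j = multiplicity v j / 4

  blockCode-injective : ∀ {m m′} (v : Vec (Fin n) m) (w : Vec (Fin n) m′) → blockCode v ≡ blockCode w →
                        ∀ i → multiplicity v i / 4 ≡ multiplicity w i / 4
  blockCode-injective v w code≡ i =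
    trans (sym (∑-blockCode-𝟙≟ v i)) (trans (cong (∑ (𝟙 ∘ (i ≟_))) code≡) (∑-blockCode-𝟙≟ w i))

  listsUpTo : ℕ → List (List (Fin n))
  listsUpTo zero    = [] ∷ []
  listsUpTo (suc H) = [] ∷ concatMap (λ i → map (i ∷_) (listsUpTo H)) (allFin n)

  ∈-listsUpTo : ∀ {H} (c : List (Fin n)) → length c ≤ H → c ∈ listsUpTo H
  ∈-listsUpTo {zero}  []      _           = here refl
  ∈-listsUpTo {suc H} []      _           = here refl
  ∈-listsUpTo {suc H} (i ∷ c) (s≤s |c|≤H) =
    there (∈-concat⁺′ (∈-map⁺ (i ∷_) (∈-listsUpTo c |c|≤H)) (∈-map⁺ _ (∈-allFin i)))

  length-listsUpTo : ∀ H → length (listsUpTo H) ≤ suc n ^ H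
  length-listsUpTo zero    = ≤-refl
  length-listsUpTo (suc H) = +-mono-≤ (m^n>0 (suc n) H) (begin
    length (concatMap (λ i → map (i ∷_) L) (allFin n))  ≡⟨ length-concatMap (λ i → map (i ∷_) L) (allFin n) ⟩
    ∑[ i ∈ allFin n ] length (map (i ∷_) L)             ≡⟨ ∑-cong (λ i → length-map (i ∷_) L) (allFin n) ⟩
    ∑[ i ∈ allFin n ] length L                          ≡⟨ ∑-const (length L) (allFin n) ⟩
    length (allFin n) * length L                        ≡⟨ cong (_* length L) (length-tabulate {n = n} (λ i → i)) ⟩
    n * length L                                        ≤⟨ *-monoʳ-≤ n (length-listsUpTo H) ⟩
    n * suc n ^ H                                       ∎)
    where
    open ≤-Reasoning
    L = listsUpTo H

-- Counting pairs of tuples with equal sums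

module _ {N k s n : ℕ} .{{_ : NonZero N}} {Λ : Fin n → Fin N} (3≤s : 3 ≤ s) (Λ∈Λ[k,s] : InFamily N k s Λ) where

  private
    Tuple = Vec (Fin n) k

    residue : Tuple → ℕ
    residue = tupleSum N Λ

  _≽_ : Tuple → Tuple → Set
  u ≽ v = residue v ≡ residue u × blocks v ≤ blocks u

  _≽?_ : ∀ u v → Dec (u ≽ v)
  u ≽? v = residue v ℕ.≟ residue u ×-dec blocks v ≤? blocks u

  ≽-total : ∀ u v → residue u ≡ residue v → u ≽ v ⊎ v ≽ u
  ≽-total u v res≡ with ≤-total (blocks v) (blocks u)
  ... | inj₁ v≤u = inj₁ (sym res≡ , v≤u)
  ... | inj₂ u≤v = inj₂ (res≡ , u≤v)

  same-residue-and-code⇒same-multiplicities : ∀ v w → residue v ≡ residue w → blockCode v ≡ blockCode w →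
                                              ∀ i → multiplicity v i ≡ multiplicity w i
  same-residue-and-code⇒same-multiplicities v w res≡ code≡ = close-multiplicities⇒equal Λ∈Λ[k,s] v w res≡ close
    where
    close : ∀ i → ∣ multiplicity v i - multiplicity w i ∣ ≤ s
    close i = ≤-trans (≤-pred (m/d≡n/d⇒∣m-n∣<d 4 {multiplicity v i} (blockCode-injective v w code≡ i))) 3≤s

  Represents : Tuple → List (Fin n) → Tuple → Set
  Represents u c w = residue w ≡ residue u × blockCode w ≡ c

  represents? : ∀ u c w → Dec (Represents u c w)
  represents? u c w = residue w ℕ.≟ residue u ×-dec ≡-decₗ _≟_ (blockCode w) c

  representative : Tuple → List (Fin n) → Tuple
  representative u c = fromMaybe u (find (represents? u c) (tuples k n))

  decode : Tuple → List (Fin n) × Vec (Fin k) k → Tuple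
  decode u (c , σ) = Vec.map (Vec.lookup (representative u c)) σ

  codes : Tuple → List (List (Fin n) × Vec (Fin k) k)
  codes u = cartesianProduct (listsUpTo (blocks u)) (tuples k k)

  ≽⇒decodable : ∀ {u v} → u ≽ v → v ∈ map (decode u) (codes u)
  ≽⇒decodable {u} {v} (res≡ , blocks≤) =
    subst (_∈ map (decode u) (codes u)) (proj₂ v≡wσ)
      (∈-map⁺ (decode u) (∈-cartesianProduct⁺ (∈-listsUpTo c |c|≤) (∈-tuples (proj₁ v≡wσ))))
    where
    c = blockCode v
    w = representative u c
    |c|≤ : length c ≤ blocks u
    |c|≤ = ≤-trans (≤-reflexive (length-blockCode v)) blocks≤
    w-represents : Represents u c w
    w-represents = find-satisfies (represents? u c) u (∈-tuples v) (res≡ , refl)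
    v≈w : ∀ i → multiplicity v i ≡ multiplicity w i
    v≈w = same-residue-and-code⇒same-multiplicities v w (trans res≡ (sym (proj₁ w-represents))) (sym (proj₂ w-represents))
    v⊆w : ∀ {x} → x ∈ᵥ v → x ∈ᵥ w
    v⊆w {x} x∈v = multiplicity>0⇒∈ w (subst (0 <_) (v≈w x) (∈⇒multiplicity>0 x∈v))
    v≡wσ : ∃[ σ ] Vec.map (Vec.lookup w) σ ≡ v
    v≡wσ = rearrangement v⊆w

  ∑-≽-≤ : ∀ u → ∑[ v ∈ tuples k n ] 𝟙 (u ≽? v) ≤ suc n ^ blocks u * k ^ k
  ∑-≽-≤ u = begin
    ∑[ v ∈ tuples k n ] 𝟙 (u ≽? v)
      ≤⟨ ∑𝟙≤length (u ≽?_) _≟ᵥ_ {tuples k n} {map (decode u) (codes u)} tuples-distinct ≽⇒decodable ⟩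
    length (map (decode u) (codes u))
      ≡⟨ length-map (decode u) (codes u) ⟩
    length (codes u)
      ≡⟨ length-cartesianProduct (listsUpTo (blocks u)) (tuples k k) ⟩
    length (listsUpTo (blocks u)) * length (tuples k k)
      ≤⟨ *-mono-≤ (length-listsUpTo (blocks u)) (≤-reflexive (length-tuples k k)) ⟩
    suc n ^ blocks u * k ^ k ∎
    where
    open ≤-Reasoning
    tuples-distinct : ∀ y → ∑[ v ∈ tuples k n ] 𝟙 (y ≟ᵥ v) ≤ 1
    tuples-distinct y = ≤-reflexive (∑-tuples-𝟙≟ y)

  T≤∑ : T N k Λ ≤ 2 * (k ^ k * (∑[ u ∈ tuples k n ] suc n ^ blocks u))
  T≤∑ = begin
    T N k Λ
      ≡⟨ length-filter (λ uv → residue (proj₁ uv) ℕ.≟ residue (proj₂ uv)) (cartesianProduct U U) ⟩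
    ∑[ uv ∈ cartesianProduct U U ] 𝟙 (residue (proj₁ uv) ℕ.≟ residue (proj₂ uv))
      ≡⟨ ∑-cartesianProduct (λ uv → 𝟙 (residue (proj₁ uv) ℕ.≟ residue (proj₂ uv))) U U ⟩
    ∑[ u ∈ U ] ∑[ v ∈ U ] 𝟙 (residue u ℕ.≟ residue v)
      ≤⟨ ∑-mono-≤ (λ u → ∑-mono-≤ (λ v → 𝟙≤𝟙+𝟙 (residue u ℕ.≟ residue v) (u ≽? v) (v ≽? u) (≽-total u v)) U) U ⟩
    ∑[ u ∈ U ] ∑[ v ∈ U ] (𝟙 (u ≽? v) + 𝟙 (v ≽? u))
      ≡⟨ ∑-cong (λ u → ∑-distrib-+ U) U ⟩
    ∑[ u ∈ U ] (∑[ v ∈ U ] 𝟙 (u ≽? v) + ∑[ v ∈ U ] 𝟙 (v ≽? u))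
      ≡⟨ ∑-distrib-+ U ⟩
    D + ∑[ u ∈ U ] ∑[ v ∈ U ] 𝟙 (v ≽? u)
      ≡⟨ cong (D +_) (∑-comm (λ u v → 𝟙 (v ≽? u)) U U) ⟩
    D + D
      ≤⟨ +-mono-≤ D≤K D≤K ⟩
    K + K
      ≡⟨ cong (K +_) (+-identityʳ K) ⟨
    2 * K ∎
    where
    open ≤-Reasoning
    U = tuples k n
    D = ∑[ u ∈ U ] ∑[ v ∈ U ] 𝟙 (u ≽? v)
    K = k ^ k * (∑[ u ∈ U ] suc n ^ blocks u)
    D≤K : D ≤ K
    D≤K = begin
      D                                    ≤⟨ ∑-mono-≤ ∑-≽-≤ U ⟩
      ∑[ u ∈ U ] suc n ^ blocks u * k ^ k  ≡⟨ ∑-cong (λ u → *-comm (suc n ^ blocks u) (k ^ k)) U ⟩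
      ∑[ u ∈ U ] k ^ k * suc n ^ blocks u  ≡⟨ *-distribˡ-∑ (k ^ k) (λ u → suc n ^ blocks u) U ⟩
      K                                    ∎

-- Sums of (n+1)^(blocks v) over all tuples

m/4*3≤m∸1 : ∀ m → m / 4 * 3 ≤ m ∸ 1
m/4*3≤m∸1 m with m / 4 | m/n*n≤m m 4
... | zero  | _         = z≤n
... | suc q | [1+q]*4≤m = ≤-trans (+-monoʳ-≤ 3 (*-monoʳ-≤ q (n≤1+n 3))) (∸-monoˡ-≤ 1 [1+q]*4≤m)

a^[1⊓m]≤1+a*m : ∀ a m → a ^ (1 ⊓ m) ≤ 1 + a * m
a^[1⊓m]≤1+a*m a zero    = s≤s z≤n
a^[1⊓m]≤1+a*m a (suc m) = ≤-trans (*-monoʳ-≤ a (s≤s (z≤n {m}))) (m≤n+m (a * suc m) 1)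

module _ {n : ℕ} where

  4*blocks≤m : ∀ {m} (v : Vec (Fin n) m) → 4 * blocks v ≤ m
  4*blocks≤m {m} v = begin
    4 * blocks v                                  ≡⟨ *-distribˡ-∑ 4 (λ i → multiplicity v i / 4) (allFin n) ⟨
    ∑[ i ∈ allFin n ] 4 * (multiplicity v i / 4)  ≤⟨ ∑-mono-≤ 4*[μ/4]≤μ (allFin n) ⟩
    ∑[ i ∈ allFin n ] multiplicity v i            ≡⟨ ∑-multiplicity v ⟩
    m                                             ∎
    where
    open ≤-Reasoning
    4*[μ/4]≤μ : ∀ i → 4 * (multiplicity v i / 4) ≤ multiplicity v i
    4*[μ/4]≤μ i = ≤-trans (≤-reflexive (*-comm 4 (multiplicity v i / 4))) (m/n*n≤m (multiplicity v i) 4)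

  blocks≤m/4 : ∀ {m} (v : Vec (Fin n) m) → blocks v ≤ m / 4
  blocks≤m/4 {m} v =
    subst (_≤ m / 4) (m*n/n≡m (blocks v) 4) (/-monoˡ-≤ 4 (≤-trans (≤-reflexive (*-comm (blocks v) 4)) (4*blocks≤m v)))

  ∑-^blocks-≤ : ∀ m → ∑[ v ∈ tuples m n ] suc n ^ blocks v ≤ n ^ m * suc n ^ (m / 4)
  ∑-^blocks-≤ m = begin
    ∑[ v ∈ tuples m n ] suc n ^ blocks v   ≤⟨ ∑-mono-≤ (λ v → ^-monoʳ-≤ (suc n) (blocks≤m/4 v)) (tuples m n) ⟩
    ∑[ v ∈ tuples m n ] suc n ^ (m / 4)    ≡⟨ ∑-const (suc n ^ (m / 4)) (tuples m n) ⟩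
    length (tuples m n) * suc n ^ (m / 4)  ≡⟨ cong (_* suc n ^ (m / 4)) (length-tuples m n) ⟩
    n ^ m * suc n ^ (m / 4)                ∎
    where open ≤-Reasoning

  repeats : ∀ {m} → Vec (Fin n) m → ℕ
  repeats v = ∑[ i ∈ allFin n ] (multiplicity v i ∸ 1)

  3*blocks≤repeats : ∀ {m} (v : Vec (Fin n) m) → 3 * blocks v ≤ repeats v
  3*blocks≤repeats v = begin
    3 * blocks v                                  ≡⟨ *-distribˡ-∑ 3 (λ i → multiplicity v i / 4) (allFin n) ⟨
    ∑[ i ∈ allFin n ] 3 * (multiplicity v i / 4)  ≤⟨ ∑-mono-≤ 3*[μ/4]≤μ∸1 (allFin n) ⟩
    repeats v                                     ∎
    where
    open ≤-Reasoning
    3*[μ/4]≤μ∸1 : ∀ i → 3 * (multiplicity v i / 4) ≤ multiplicity v i ∸ 1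
    3*[μ/4]≤μ∸1 i = ≤-trans (≤-reflexive (*-comm 3 (multiplicity v i / 4))) (m/4*3≤m∸1 (multiplicity v i))

  repeats-∷ : ∀ {m} x (w : Vec (Fin n) m) → repeats (x ∷ w) ≡ repeats w + 1 ⊓ multiplicity w x
  repeats-∷ x w = begin
    ∑[ i ∈ allFin n ] ((𝟙 (x ≟ i) + μ i) ∸ 1)           ≡⟨ ∑-cong (λ i → [𝟙+m]∸1 (x ≟ i) (μ i)) (allFin n) ⟩
    ∑[ i ∈ allFin n ] ((μ i ∸ 1) + 𝟙 (x ≟ i) * (1 ⊓ μ i)) ≡⟨ ∑-distrib-+ (allFin n) ⟩
    repeats w + ∑[ i ∈ allFin n ] 𝟙 (x ≟ i) * (1 ⊓ μ i)  ≡⟨ cong (repeats w +_) (∑-𝟙≟ x (λ i → 1 ⊓ μ i)) ⟩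
    repeats w + 1 ⊓ μ x                                  ∎
    where
    open ≡-Reasoning
    μ = multiplicity w

  a^repeats-∷ : ∀ a {m} x (w : Vec (Fin n) m) → a ^ repeats (x ∷ w) ≤ a ^ repeats w * (1 + a * multiplicity w x)
  a^repeats-∷ a x w = begin
    a ^ repeats (x ∷ w)                         ≡⟨ cong (a ^_) (repeats-∷ x w) ⟩
    a ^ (repeats w + 1 ⊓ multiplicity w x)      ≡⟨ ^-distribˡ-+-* a (repeats w) _ ⟩
    a ^ repeats w * a ^ (1 ⊓ multiplicity w x)  ≤⟨ *-monoʳ-≤ (a ^ repeats w) (a^[1⊓m]≤1+a*m a (multiplicity w x)) ⟩
    a ^ repeats w * (1 + a * multiplicity w x)  ∎
    where open ≤-Reasoning

  ∑-1+a*multiplicity : ∀ a {m} (w : Vec (Fin n) m) → ∑[ i ∈ allFin n ] (1 + a * multiplicity w i) ≡ n + a * m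
  ∑-1+a*multiplicity a {m} w = begin
    ∑[ i ∈ allFin n ] (1 + a * multiplicity w i)
      ≡⟨ ∑-distrib-+ (allFin n) ⟩
    ∑[ i ∈ allFin n ] 1 + ∑[ i ∈ allFin n ] a * multiplicity w i
      ≡⟨ cong₂ _+_ (sym (length≡∑1 (allFin n))) (*-distribˡ-∑ a (multiplicity w) (allFin n)) ⟩
    length (allFin n) + a * ∑ (multiplicity w) (allFin n)
      ≡⟨ cong₂ _+_ (length-tabulate {n = n} (λ i → i)) (cong (a *_) (∑-multiplicity w)) ⟩
    n + a * m ∎
    where open ≡-Reasoning

  ∑-^repeats-≤ : ∀ a {K} m → m ≤ K → ∑[ v ∈ tuples m n ] a ^ repeats v ≤ (n + a * K) ^ m
  ∑-^repeats-≤ a zero          _   = ≤-reflexive (cong (λ r → a ^ r + 0) (∑-zero (allFin n)))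
  ∑-^repeats-≤ a {K} (suc m) m<K = begin
    ∑[ v ∈ tuples (suc m) n ] a ^ repeats v
      ≡⟨ ∑-tuples-suc (λ v → a ^ repeats v) ⟩
    ∑[ i ∈ allFin n ] ∑[ w ∈ W ] a ^ repeats (i ∷ w)
      ≤⟨ ∑-mono-≤ (λ i → ∑-mono-≤ (a^repeats-∷ a i) W) (allFin n) ⟩
    ∑[ i ∈ allFin n ] ∑[ w ∈ W ] a ^ repeats w * (1 + a * multiplicity w i)
      ≡⟨ ∑-comm (λ i w → a ^ repeats w * (1 + a * multiplicity w i)) (allFin n) W ⟩
    ∑[ w ∈ W ] ∑[ i ∈ allFin n ] a ^ repeats w * (1 + a * multiplicity w i)
      ≡⟨ ∑-cong (λ w → *-distribˡ-∑ (a ^ repeats w) (λ i → 1 + a * multiplicity w i) (allFin n)) W ⟩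
    ∑[ w ∈ W ] a ^ repeats w * (∑[ i ∈ allFin n ] (1 + a * multiplicity w i))
      ≤⟨ ∑-mono-≤ (λ w → *-monoʳ-≤ (a ^ repeats w) (∑[1+a*μ]≤L w)) W ⟩
    ∑[ w ∈ W ] a ^ repeats w * L
      ≡⟨ ∑-cong (λ w → *-comm (a ^ repeats w) L) W ⟩
    ∑[ w ∈ W ] L * a ^ repeats w
      ≡⟨ *-distribˡ-∑ L (λ w → a ^ repeats w) W ⟩
    L * (∑[ w ∈ W ] a ^ repeats w)
      ≤⟨ *-monoʳ-≤ L (∑-^repeats-≤ a m (<⇒≤ m<K)) ⟩
    L * L ^ m ∎
    where
    open ≤-Reasoning
    W = tuples m n
    L = n + a * K
    ∑[1+a*μ]≤L : ∀ w → ∑[ i ∈ allFin n ] (1 + a * multiplicity w i) ≤ L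
    ∑[1+a*μ]≤L w = ≤-trans (≤-reflexive (∑-1+a*multiplicity a w)) (+-monoʳ-≤ n (*-monoʳ-≤ a (<⇒≤ m<K)))

module _ {k n : ℕ} .{{_ : NonZero k}} (k*k≤n : k * k ≤ n) (k≤n : k ≤ n) where

  ∑-^blocks-≤-dense : ∑[ v ∈ tuples k n ] suc n ^ blocks v ≤ (4 * n) ^ k
  ∑-^blocks-≤-dense = begin
    ∑[ v ∈ tuples k n ] suc n ^ blocks v    ≤⟨ ∑-mono-≤ (λ v → ^-monoˡ-≤ (blocks v) 1+n≤a^3) (tuples k n) ⟩
    ∑[ v ∈ tuples k n ] (a ^ 3) ^ blocks v  ≤⟨ ∑-mono-≤ a^[3b]≤a^repeats (tuples k n) ⟩
    ∑[ v ∈ tuples k n ] a ^ repeats v       ≤⟨ ∑-^repeats-≤ a k ≤-refl ⟩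
    (n + a * k) ^ k                         ≤⟨ ^-monoˡ-≤ k n+a*k≤4*n ⟩
    (4 * n) ^ k                             ∎
    where
    open ≤-Reasoning
    q = n / k
    a = 2 + q

    k≤q : k ≤ q
    k≤q = subst (_≤ q) (m*n/n≡m k k) (/-monoˡ-≤ k k*k≤n)

    1+n≤a^3 : suc n ≤ a ^ 3
    1+n≤a^3 = begin-strict
      n                  ≡⟨ m≡m%n+[m/n]*n n k ⟩
      n % k + q * k      <⟨ +-monoˡ-< (q * k) (m%n<n n k) ⟩
      suc q * k          ≤⟨ *-mono-≤ (n≤1+n (suc q)) (≤-trans k≤q (≤-trans (m≤n+m q 2) (m≤m*n a (a * 1)))) ⟩
      a * (a * (a * 1))  ∎

    a^[3b]≤a^repeats : ∀ v → (a ^ 3) ^ blocks v ≤ a ^ repeats v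
    a^[3b]≤a^repeats v = ≤-trans (≤-reflexive (^-*-assoc a 3 (blocks v))) (^-monoʳ-≤ a (3*blocks≤repeats v))

    n+a*k≤4*n : n + a * k ≤ 4 * n
    n+a*k≤4*n = begin
      n + a * k            ≡⟨ cong (n +_) (*-distribʳ-+ k 2 q) ⟩
      n + (2 * k + q * k)  ≤⟨ +-monoʳ-≤ n (+-mono-≤ (*-monoʳ-≤ 2 k≤n) (m/n*n≤m n k)) ⟩
      n + (2 * n + n)      ≡⟨ regroup n ⟩
      4 * n                ∎
      where
      regroup : ∀ n → n + (2 * n + n) ≡ 4 * n
      regroup = ℕ-Solver.solve-∀

^-distribʳ-* : ∀ m n o → (m * n) ^ o ≡ m ^ o * n ^ o
^-distribʳ-* m n zero    = refl
^-distribʳ-* m n (suc o) = trans (cong (m * n *_) (^-distribʳ-* m n o)) (*-interchange m n (m ^ o) (n ^ o))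

[m*m]^n≡m^[2*n] : ∀ m n → (m * m) ^ n ≡ m ^ (2 * n)
[m*m]^n≡m^[2*n] m n = trans (cong (λ x → (m * x) ^ n) (sym (*-identityʳ m))) (^-*-assoc m 2 n)

^-cancelˡ-≤ : ∀ b {m n} → 1 < b → b ^ m ≤ b ^ n → m ≤ n
^-cancelˡ-≤ b 1<b b^m≤b^n = ≮⇒≥ (λ n<m → <⇒≱ (^-monoʳ-< b 1<b n<m) b^m≤b^n)

b^x≤c^y∧c^u≤b^w⇒x*u≤w*y : ∀ b {c x y u w} → 1 < b → b ^ x ≤ c ^ y → c ^ u ≤ b ^ w → x * u ≤ w * y
b^x≤c^y∧c^u≤b^w⇒x*u≤w*y b {c} {x} {y} {u} {w} 1<b b^x≤c^y c^u≤b^w = ^-cancelˡ-≤ b 1<b (begin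
  b ^ (x * u)  ≡⟨ ^-*-assoc b x u ⟨
  (b ^ x) ^ u  ≤⟨ ^-monoˡ-≤ u b^x≤c^y ⟩
  (c ^ y) ^ u  ≡⟨ ^-*-assoc c y u ⟩
  c ^ (y * u)  ≡⟨ cong (c ^_) (*-comm y u) ⟩
  c ^ (u * y)  ≡⟨ ^-*-assoc c u y ⟨
  (c ^ u) ^ y  ≤⟨ ^-monoˡ-≤ y c^u≤b^w ⟩
  (b ^ w) ^ y  ≡⟨ ^-*-assoc b w y ⟩
  b ^ (w * y)  ∎)
  where open ≤-Reasoning

x*A^q<T^q⇒x<Y^q : ∀ {x T} A Y q → T ≤ A * Y → x * A ^ q < T ^ q → x < Y ^ q
x*A^q<T^q⇒x<Y^q {x} {T} A Y q T≤A*Y x*A^q<T^q = *-cancelʳ-< (A ^ q) x (Y ^ q) (begin-strict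
  x * A ^ q      <⟨ x*A^q<T^q ⟩
  T ^ q          ≤⟨ ^-monoˡ-≤ q T≤A*Y ⟩
  (A * Y) ^ q    ≡⟨ ^-distribʳ-* A Y q ⟩
  A ^ q * Y ^ q  ≡⟨ *-comm (A ^ q) (Y ^ q) ⟩
  Y ^ q * A ^ q  ∎)
  where open ≤-Reasoning

2*4^k≤2^[9*k] : ∀ {k} → 1 ≤ k → 2 * 4 ^ k ≤ 2 ^ (9 * k)
2*4^k≤2^[9*k] {k} 1≤k = begin
  2 * 4 ^ k        ≡⟨ cong (2 *_) (^-*-assoc 2 2 k) ⟩
  2 ^ (1 + 2 * k)  ≤⟨ ^-monoʳ-≤ 2 (+-mono-≤ 1≤k (*-monoˡ-≤ k {2} {8} (s≤s (s≤s z≤n)))) ⟩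
  2 ^ (9 * k)      ∎
  where open ≤-Reasoning

module _ {k n : ℕ} (1≤k : 1 ≤ k) (n<k*k : n < k * k) where

  private instance
    k≢0 : NonZero k
    k≢0 = >-nonZero 1≤k

  2^[4p]≤k^[2kq] : ∀ {p q} → 2 ^ p < (suc n ^ (k / 4)) ^ q → 2 ^ (p * 4) ≤ k ^ (2 * k * q)
  2^[4p]≤k^[2kq] {p} {q} 2^p<Y^q = begin
    2 ^ (p * 4)        ≡⟨ ^-*-assoc 2 p 4 ⟨
    (2 ^ p) ^ 4        ≤⟨ ^-monoˡ-≤ 4 (<⇒≤ 2^p<Y^q) ⟩
    (Y ^ q) ^ 4        ≡⟨ trans (^-*-assoc Y q 4) (trans (cong (Y ^_) (*-comm q 4)) (sym (^-*-assoc Y 4 q))) ⟩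
    (Y ^ 4) ^ q        ≤⟨ ^-monoˡ-≤ q Y^4≤k^[2k] ⟩
    (k ^ (2 * k)) ^ q  ≡⟨ ^-*-assoc k (2 * k) q ⟩
    k ^ (2 * k * q)    ∎
    where
    open ≤-Reasoning
    Y = suc n ^ (k / 4)
    Y^4≤k^[2k] : Y ^ 4 ≤ k ^ (2 * k)
    Y^4≤k^[2k] = begin
      Y ^ 4                ≡⟨ ^-*-assoc (suc n) (k / 4) 4 ⟩
      suc n ^ (k / 4 * 4)  ≤⟨ ^-monoʳ-≤ (suc n) (m/n*n≤m k 4) ⟩
      suc n ^ k            ≤⟨ ^-monoˡ-≤ k n<k*k ⟩
      (k * k) ^ k          ≡⟨ [m*m]^n≡m^[2*n] k k ⟩
      k ^ (2 * k)          ∎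

  [k^[2s]*n^[s∸2]]^q≤k^[[2s+2s]q] : ∀ s q → (k ^ (2 * s) * n ^ (s ∸ 2)) ^ q ≤ k ^ ((2 * s + 2 * s) * q)
  [k^[2s]*n^[s∸2]]^q≤k^[[2s+2s]q] s q = begin
    (k ^ (2 * s) * n ^ (s ∸ 2)) ^ q  ≤⟨ ^-monoˡ-≤ q (*-monoʳ-≤ (k ^ (2 * s)) n^[s∸2]≤k^[2s]) ⟩
    (k ^ (2 * s) * k ^ (2 * s)) ^ q  ≡⟨ cong (_^ q) (^-distribˡ-+-* k (2 * s) (2 * s)) ⟨
    (k ^ (2 * s + 2 * s)) ^ q        ≡⟨ ^-*-assoc k (2 * s + 2 * s) q ⟩
    k ^ ((2 * s + 2 * s) * q)        ∎
    where
    open ≤-Reasoning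
    n^[s∸2]≤k^[2s] : n ^ (s ∸ 2) ≤ k ^ (2 * s)
    n^[s∸2]≤k^[2s] = begin
      n ^ (s ∸ 2)        ≤⟨ ^-monoˡ-≤ (s ∸ 2) (<⇒≤ n<k*k) ⟩
      (k * k) ^ (s ∸ 2)  ≡⟨ [m*m]^n≡m^[2*n] k (s ∸ 2) ⟩
      k ^ (2 * (s ∸ 2))  ≤⟨ ^-monoʳ-≤ k (*-monoʳ-≤ 2 (m∸n≤m s 2)) ⟩
      k ^ (2 * s)        ∎

product-of-log-bounds : ∀ k s p q p′ q′ p″ q″ →
                        2 ^ (p * 4) ≤ k ^ (2 * k * q) → 2 ^ p′ ≤ k ^ ((2 * s + 2 * s) * q′) → k ^ q″ ≤ 2 ^ p″ →
                        p * p′ * q″ ^ 2 ≤ 2 * s * k * p″ ^ 2 * q * q′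
product-of-log-bounds k s p q p′ q′ p″ q″ h h′ h″ =
  *-cancelˡ-≤ 4 (subst₂ _≤_ (lhs p p′ q″) (rhs p″ k q s q′) (*-mono-≤ 4pq″≤2kqp″ p′q″≤[2s+2s]q′p″))
  where
  1<2 : 1 < 2
  1<2 = s≤s (s≤s z≤n)
  4pq″≤2kqp″ : p * 4 * q″ ≤ p″ * (2 * k * q)
  4pq″≤2kqp″ = b^x≤c^y∧c^u≤b^w⇒x*u≤w*y 2 {k} {p * 4} {2 * k * q} {q″} {p″} 1<2 h h″
  p′q″≤[2s+2s]q′p″ : p′ * q″ ≤ p″ * ((2 * s + 2 * s) * q′)
  p′q″≤[2s+2s]q′p″ = b^x≤c^y∧c^u≤b^w⇒x*u≤w*y 2 {k} {p′} {(2 * s + 2 * s) * q′} {q″} {p″} 1<2 h′ h″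
  -- c * (c * 1) is c ^ 2 unfolded: the solver does not reflect _^_.
  lhs : ∀ a b c → a * 4 * c * (b * c) ≡ 4 * (a * b * (c * (c * 1)))
  lhs = ℕ-Solver.solve-∀
  rhs : ∀ a b c d e → a * (2 * b * c) * (a * ((2 * d + 2 * d) * e)) ≡ 4 * (2 * d * b * (a * (a * 1)) * c * e)
  rhs = ℕ-Solver.solve-∀

-- The two regimes

module _ {N k s n : ℕ} .{{_ : NonZero N}} (1≤k : 1 ≤ k) (3≤s : 3 ≤ s)
         (Λ : Fin n → Fin N) (Λ∈Λ[k,s] : InFamily N k s Λ) where

  private
    instance
      k≢0 : NonZero k
      k≢0 = >-nonZero 1≤k

    A₀ : ℕ
    A₀ = 2 ^ (9 * k) * k ^ k * n ^ k

    T≤A₀*[1+n]^[k/4] : T N k Λ ≤ A₀ * suc n ^ (k / 4)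
    T≤A₀*[1+n]^[k/4] = begin
      T N k Λ
        ≤⟨ T≤∑ {k = k} 3≤s Λ∈Λ[k,s] ⟩
      2 * (k ^ k * (∑[ u ∈ tuples k n ] suc n ^ blocks u))
        ≤⟨ *-monoʳ-≤ 2 (*-monoʳ-≤ (k ^ k) (∑-^blocks-≤ k)) ⟩
      2 * (k ^ k * (n ^ k * Y))
        ≡⟨ regroup 2 (k ^ k) (n ^ k) Y ⟩
      2 * k ^ k * n ^ k * Y
        ≤⟨ *-monoˡ-≤ Y (*-monoˡ-≤ (n ^ k) (*-monoˡ-≤ (k ^ k) 2≤2^[9k])) ⟩
      A₀ * Y ∎
      where
      open ≤-Reasoning
      Y = suc n ^ (k / 4)
      2≤2^[9k] : 2 ≤ 2 ^ (9 * k)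
      2≤2^[9k] = ^-monoʳ-≤ 2 (≤-trans 1≤k (m≤n*m k 9))
      regroup : ∀ a b c d → a * (b * (c * d)) ≡ a * b * c * d
      regroup = ℕ-Solver.solve-∀

    T≤A₀ : k * k ≤ n → k ≤ n → T N k Λ ≤ A₀ * 1
    T≤A₀ k*k≤n k≤n = begin
      T N k Λ
        ≤⟨ T≤∑ {k = k} 3≤s Λ∈Λ[k,s] ⟩
      2 * (k ^ k * (∑[ u ∈ tuples k n ] suc n ^ blocks u))
        ≤⟨ *-monoʳ-≤ 2 (*-monoʳ-≤ (k ^ k) (∑-^blocks-≤-dense k*k≤n k≤n)) ⟩
      2 * (k ^ k * (4 * n) ^ k)
        ≡⟨ cong (λ x → 2 * (k ^ k * x)) (^-distribʳ-* 4 n k) ⟩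
      2 * (k ^ k * (4 ^ k * n ^ k))
        ≡⟨ regroup 2 (k ^ k) (4 ^ k) (n ^ k) ⟩
      2 * 4 ^ k * k ^ k * n ^ k * 1
        ≤⟨ *-monoˡ-≤ 1 (*-monoˡ-≤ (n ^ k) (*-monoˡ-≤ (k ^ k) (2*4^k≤2^[9*k] 1≤k))) ⟩
      A₀ * 1 ∎
      where
      open ≤-Reasoning
      regroup : ∀ a b c d → a * (b * (c * d)) ≡ a * c * b * d * 1
      regroup = ℕ-Solver.solve-∀

  dense-regime : k * k ≤ n → k ≤ n → ∀ p q → 2 ^ p * A₀ ^ q < T N k Λ ^ q → ⊥
  dense-regime k*k≤n k≤n p q 2^pA₀^q<T^q = <⇒≱ 2^p<1 (m^n>0 2 p)
    where
    2^p<1 : 2 ^ p < 1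
    2^p<1 = subst (2 ^ p <_) (^-zeroˡ q) (x*A^q<T^q⇒x<Y^q A₀ 1 q (T≤A₀ k*k≤n k≤n) 2^pA₀^q<T^q)

  sparse-regime : n < k * k → ∀ p q → 2 ^ p * A₀ ^ q < T N k Λ ^ q → 2 ^ (p * 4) ≤ k ^ (2 * k * q)
  sparse-regime n<k*k p q 2^pA₀^q<T^q =
    2^[4p]≤k^[2kq] 1≤k n<k*k {p} {q} (x*A^q<T^q⇒x<Y^q A₀ (suc n ^ (k / 4)) q T≤A₀*[1+n]^[k/4] 2^pA₀^q<T^q)

mainTheorem8 : (N k s : ℕ) .{{_ : NonZero N}} → 1 ≤ k → 3 ≤ s →
    {n : ℕ} (Λ : Fin n → Fin N) → Injective _≡_ _≡_ Λ →
    InFamily N k s Λ → k ≤ n →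
    (p q p′ q′ p″ q″ : ℕ) →
    2 ^ p * (2 ^ (9 * k) * k ^ k * n ^ k) ^ q < T N k Λ ^ q →
    2 ^ p′ < (k ^ (2 * s) * n ^ (s ∸ 2)) ^ q′ →
    k ^ q″ < 2 ^ p″ →
    p * p′ * q″ ^ 2 ≤ 2 * s * k * p″ ^ 2 * q * q′
mainTheorem8 N k s 1≤k 3≤s {n} Λ _ Λ∈Λ[k,s] k≤n p q p′ q′ p″ q″ 2^pA^q<T^q 2^p′<M^q′ k^q″<2^p″
  with k * k ≤? n
... | yes k*k≤n = ⊥-elim (dense-regime 1≤k 3≤s Λ Λ∈Λ[k,s] k*k≤n k≤n p q 2^pA^q<T^q)
... | no  k*k≰n = product-of-log-bounds k s p q p′ q′ p″ q″
                    (sparse-regime 1≤k 3≤s Λ Λ∈Λ[k,s] n<k*k p q 2^pA^q<T^q)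
                    (≤-trans (<⇒≤ 2^p′<M^q′) ([k^[2s]*n^[s∸2]]^q≤k^[[2s+2s]q] 1≤k n<k*k s q′))
                    (<⇒≤ k^q″<2^p″)
  where
  n<k*k : n < k * k
  n<k*k = ≰⇒> k*k≰n
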